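{- Let $\mathcal{T}_i=(X_i,\leq_{\mathcal{T}_i})$, $i=1,2,3$, be three connected finite topological spaces on pairwise disjoint sets, and let $u\in X_2$ and $v,w\in X_3$. Then (1) $(\mathcal{T}_1\searrow_u\mathcal{T}_2)\searrow_w\mathcal{T}_3=\mathcal{T}_1\searrow_u(\mathcal{T}_2\searrow_w\mathcal{T}_3)$; (2) $\mathcal{T}_1\searrow_v(\mathcal{T}_2\searrow_w\mathcal{T}_3)=\mathcal{T}_2\searrow_w(\mathcal{T}_1\searrow_v\mathcal{T}_3)$.
   Context: A finite topological space is a finite set with a preorder $\leq$ (open sets are the upper sets). For finite topological spaces $\mathcal{A}=(A,\leq_{\mathcal{A}})$, $\mathcal{B}=(B,\leq_{\mathcal{B}})$ on disjoint sets and $v\in B$, the space $\mathcal{A}\searrow_v\mathcal{B}=(A\sqcup B,\leq)$ is defined by: $x\leq y$ iff either ($x,y\in A$ and $x\leq_{\mathcal{A}}y$), or ($x,y\in B$ and $x\leq_{\mathcal{B}}y$), or ($x\in B$, $y\in A$ and $x\leq_{\mathcal{B}}v$). (Here in (1), $u\in X_2\subset X_1\sqcup X_2$ and $u\in X_2\subset X_2\sqcup X_3$; in (2), $v\in X_3\subset X_2\sqcup X_3$ and $w\in X_3\subset X_1\sqcup X_3$.) -}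

module Defs where

open import Level using (0ℓ)
open import Data.Nat using (ℕ; _+_)
open import Data.Fin using (Fin)
open import Data.Fin.Properties using (+↔⊎)
open import Data.Sum using (_⊎_; inj₁; inj₂)
open import Data.Empty using (⊥)
open import Data.Product using (_×_)
open import Function.Bundles using (_↔_; _⇔_)
open import Function.Properties.Inverse using (↔-trans; ↔-sym)
open import Data.Sum.Function.Propositional using (_⊎-↔_)
open import Relation.Binary.Core using (Rel)
open import Relation.Binary.Structures using (IsPreorder)
open import Relation.Binary.PropositionalEquality using (_≡_; refl; isEquivalence)
open import Relation.Binary.Construct.Closure.Equivalence using (EqClosure)

-- A finite topological space: a finite set (in bijection with Fin size)
-- with a preorder (open sets = upper sets).
record FinTopSpace : Set₁ where
  field
    Carrier    : Set
    size       : ℕ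
    finite     : Carrier ↔ Fin size
    _≤_        : Rel Carrier 0ℓ
    isPreorder : IsPreorder _≡_ _≤_

open FinTopSpace public

-- Connected finite space: any two points are joined by a fence
-- (zigzag of comparabilities), i.e. the equivalence closure of ≤ is total.
Connected : FinTopSpace → Set
Connected T = ∀ x y → EqClosure (_≤_ T) x y

module _ (A B : FinTopSpace) (v : Carrier B) where
  data SLe : Rel (Carrier A ⊎ Carrier B) 0ℓ where
    AA : ∀ {x y} → _≤_ A x y → SLe (inj₁ x) (inj₁ y)
    BB : ∀ {x y} → _≤_ B x y → SLe (inj₂ x) (inj₂ y)
    BA : ∀ {x y} → _≤_ B x v → SLe (inj₂ x) (inj₁ y)

  private
    module PA = IsPreorder (isPreorder A)
    module PB = IsPreorder (isPreorder B)

    sRefl : ∀ {x y} → x ≡ y → SLe x y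
    sRefl {inj₁ x} refl = AA PA.refl
    sRefl {inj₂ x} refl = BB PB.refl

    sTrans : ∀ {x y z} → SLe x y → SLe y z → SLe x z
    sTrans (AA p) (AA q) = AA (PA.trans p q)
    sTrans (BB p) (BB q) = BB (PB.trans p q)
    sTrans (BB p) (BA q) = BA (PB.trans p q)
    sTrans (BA p) (AA q) = BA p

  slash : FinTopSpace
  slash = record
    { Carrier    = Carrier A ⊎ Carrier B
    ; size       = size A + size B
    ; finite     = ↔-trans (finite A ⊎-↔ finite B) (↔-sym +↔⊎)
    ; _≤_        = SLe
    ; isPreorder = record { isEquivalence = isEquivalence ; reflexive = sRefl ; trans = sTrans }
    }

-- slash A B v  denotes  A ↘_v B  (v : Carrier B).

swap12 : {X₁ X₂ X₃ : Set} → X₁ ⊎ (X₂ ⊎ X₃) → X₂ ⊎ (X₁ ⊎ X₃)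
swap12 (inj₁ x) = inj₂ (inj₁ x)
swap12 (inj₂ (inj₁ y)) = inj₁ y
swap12 (inj₂ (inj₂ z)) = inj₂ (inj₂ z)

-- Two spaces are equal along an identification f of their underlying sets
-- (f is the canonical identification of the disjoint unions) when f
-- preserves and reflects the order.
SameSpace : (S T : FinTopSpace) → (Carrier S → Carrier T) → Set
SameSpace S T f = ∀ x y → _≤_ S x y ⇔ _≤_ T (f x) (f y)

{-# OPTIONS --safe #-}
module Submission where

open import Defs
open import Data.Sum using (inj₁; inj₂)
open import Data.Sum.Base using (assocʳ)
open import Data.Product using (_×_; _,_)
open import Function.Bundles using (mk⇔)

module _ (T₁ T₂ T₃ : FinTopSpace) where

  module _ (u : Carrier T₂) (w : Carrier T₃) where
    private
      L = slash (slash T₁ T₂ u) T₃ w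
      R = slash T₁ (slash T₂ T₃ w) (inj₁ u)

    slash-assocʳ-mono : ∀ x y → _≤_ L x y → _≤_ R (assocʳ x) (assocʳ y)
    slash-assocʳ-mono (inj₁ (inj₁ x)) (inj₁ (inj₁ y)) (AA (AA x≤y)) = AA x≤y
    slash-assocʳ-mono (inj₁ (inj₂ x)) (inj₁ (inj₂ y)) (AA (BB x≤y)) = BB (AA x≤y)
    slash-assocʳ-mono (inj₁ (inj₂ x)) (inj₁ (inj₁ y)) (AA (BA x≤u)) = BA (AA x≤u)
    slash-assocʳ-mono (inj₂ x)        (inj₂ y)        (BB x≤y)      = BB (BB x≤y)
    slash-assocʳ-mono (inj₂ x)        (inj₁ (inj₁ y)) (BA x≤w)      = BA (BA x≤w)
    slash-assocʳ-mono (inj₂ x)        (inj₁ (inj₂ y)) (BA x≤w)      = BB (BA x≤w)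

    slash-assocʳ-reflects : ∀ x y → _≤_ R (assocʳ x) (assocʳ y) → _≤_ L x y
    slash-assocʳ-reflects (inj₁ (inj₁ x)) (inj₁ (inj₁ y)) (AA x≤y)      = AA (AA x≤y)
    slash-assocʳ-reflects (inj₁ (inj₂ x)) (inj₁ (inj₂ y)) (BB (AA x≤y)) = AA (BB x≤y)
    slash-assocʳ-reflects (inj₁ (inj₂ x)) (inj₁ (inj₁ y)) (BA (AA x≤u)) = AA (BA x≤u)
    slash-assocʳ-reflects (inj₁ (inj₂ x)) (inj₂ y)        (BB ())
    slash-assocʳ-reflects (inj₂ x)        (inj₂ y)        (BB (BB x≤y)) = BB x≤y
    slash-assocʳ-reflects (inj₂ x)        (inj₁ (inj₁ y)) (BA (BA x≤w)) = BA x≤w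
    slash-assocʳ-reflects (inj₂ x)        (inj₁ (inj₂ y)) (BB (BA x≤w)) = BA x≤w

    slash-assoc : SameSpace L R assocʳ
    slash-assoc x y = mk⇔ (slash-assocʳ-mono x y) (slash-assocʳ-reflects x y)

  module _ (v w : Carrier T₃) where
    private
      L = slash T₁ (slash T₂ T₃ w) (inj₂ v)
      R = slash T₂ (slash T₁ T₃ v) (inj₂ w)

    slash-swap12-mono : ∀ x y → _≤_ L x y → _≤_ R (swap12 x) (swap12 y)
    slash-swap12-mono (inj₁ x)        (inj₁ y)        (AA x≤y)      = BB (AA x≤y)
    slash-swap12-mono (inj₂ (inj₁ x)) (inj₂ (inj₁ y)) (BB (AA x≤y)) = AA x≤y
    slash-swap12-mono (inj₂ (inj₁ x)) (inj₁ y)        (BA ())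
    slash-swap12-mono (inj₂ (inj₂ x)) (inj₂ (inj₁ y)) (BB (BA x≤w)) = BA (BB x≤w)
    slash-swap12-mono (inj₂ (inj₂ x)) (inj₂ (inj₂ y)) (BB (BB x≤y)) = BB (BB x≤y)
    slash-swap12-mono (inj₂ (inj₂ x)) (inj₁ y)        (BA (BB x≤v)) = BB (BA x≤v)

    slash-swap12-reflects : ∀ x y → _≤_ R (swap12 x) (swap12 y) → _≤_ L x y
    slash-swap12-reflects (inj₁ x)        (inj₁ y)        (BB (AA x≤y)) = AA x≤y
    slash-swap12-reflects (inj₁ x)        (inj₂ (inj₁ y)) (BA ())
    slash-swap12-reflects (inj₁ x)        (inj₂ (inj₂ y)) (BB ())
    slash-swap12-reflects (inj₂ (inj₁ x)) (inj₂ (inj₁ y)) (AA x≤y)      = BB (AA x≤y)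
    slash-swap12-reflects (inj₂ (inj₂ x)) (inj₂ (inj₁ y)) (BA (BB x≤w)) = BB (BA x≤w)
    slash-swap12-reflects (inj₂ (inj₂ x)) (inj₂ (inj₂ y)) (BB (BB x≤y)) = BB (BB x≤y)
    slash-swap12-reflects (inj₂ (inj₂ x)) (inj₁ y)        (BB (BA x≤v)) = BA (BB x≤v)

    slash-exchange : SameSpace L R swap12
    slash-exchange x y = mk⇔ (slash-swap12-mono x y) (slash-swap12-reflects x y)

mainTheorem2 : (T₁ T₂ T₃ : FinTopSpace) →
    Connected T₁ → Connected T₂ → Connected T₃ →
    (u : Carrier T₂) (v w : Carrier T₃) →
    SameSpace (slash (slash T₁ T₂ u) T₃ w) (slash T₁ (slash T₂ T₃ w) (inj₁ u)) assocʳ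
    × SameSpace (slash T₁ (slash T₂ T₃ w) (inj₂ v)) (slash T₂ (slash T₁ T₃ v) (inj₂ w)) swap12
mainTheorem2 T₁ T₂ T₃ _ _ _ u v w = slash-assoc T₁ T₂ T₃ u w , slash-exchange T₁ T₂ T₃ v w
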